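{- ${\sf SCAC}$ and $\omega\text{ - }{\sf SCAC}$ are computably equivalent: ${\sf SCAC}\le_c\omega\text{ - }{\sf SCAC}$ and $\omega\text{ - }{\sf SCAC}\le_c{\sf SCAC}$.
   Context: A poset $(P,\le_P)$ consists of $P\subseteq\omega$ and a reflexive, antisymmetric, transitive relation $\le_P$; chains (antichains) are sets of pairwise comparable (incomparable) elements; it is $\omega$-ordered if $x\le_P y$ implies $x\le y$. In an infinite poset, $x$ is small if $x\le_P y$ for all but finitely many $y\in P$, large if $y\le_P x$ for all but finitely many $y$, isolated if $x$ is incomparable with all but finitely many $y$; the poset is stable if every element is small or isolated, or every element is large or isolated. ${\sf SCAC}$ is the problem whose instances are infinite stable posets with $P\subseteq\omega$ and whose solutions are infinite chains or infinite antichains of the instance; $\omega\text{ - }{\sf SCAC}$ is its restriction to $\omega$-ordered instances. $\mathsf P\le_c\mathsf Q$ means: for every $\mathsf P$-instance $X$ there is a $\mathsf Q$-instance $\hat X\le_T X$ such that for every solution $\hat Y$ of $\hat X$ there is a solution $Y$ of $X$ with $Y\le_T X\oplus\hat Y$. -}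

module Defs where

open import Data.Nat using (ℕ; zero; suc; _+_; _*_; _≤_; _<_)
open import Data.Bool using (Bool; true; false; if_then_else_)
open import Data.Fin using (Fin)
open import Data.Vec using (Vec; []; _∷_; lookup)
open import Data.Product using (Σ; ∃; _×_; _,_)
open import Data.Sum using (_⊎_)
open import Relation.Nullary using (¬_)
open import Relation.Binary.PropositionalEquality using (_≡_; _≢_)

Setω : Set
Setω = ℕ → Bool

_∈_ : ℕ → Setω → Set
n ∈ A = A n ≡ true

-- Cantor pairing (a bijection ℕ × ℕ → ℕ)
tri : ℕ → ℕ
tri zero    = 0
tri (suc n) = suc n + tri n

pair : ℕ → ℕ → ℕ
pair x y = tri (x + y) + y

half : ℕ → ℕ
half zero = zero
half (suc zero) = zero
half (suc (suc n)) = suc (half n)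

isEven : ℕ → Bool
isEven zero = true
isEven (suc zero) = false
isEven (suc (suc n)) = isEven n

_⊕_ : Setω → Setω → Setω
(A ⊕ B) n = if isEven n then A (half n) else B (half n)

-- Oracle (partial) μ-recursive functions, the standard model of
-- relative computability.

data Code : ℕ → Set where
  zeroC  : ∀ {n} → Code n
  succC  : Code 1
  projC  : ∀ {n} → Fin n → Code n
  oracleC : Code 1
  compC  : ∀ {m n} → Code m → Vec (Code n) m → Code n
  precC  : ∀ {n} → Code n → Code (suc (suc n)) → Code (suc n)
  muC    : ∀ {n} → Code (suc n) → Code n

χ : Bool → ℕ
χ true  = 1
χ false = 0

mutual
  data Eval (O : Setω) : ∀ {n} → Code n → Vec ℕ n → ℕ → Set where
    ev-zero   : ∀ {n} {xs : Vec ℕ n} → Eval O zeroC xs 0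
    ev-succ   : ∀ {x} → Eval O succC (x ∷ []) (suc x)
    ev-proj   : ∀ {n} {i : Fin n} {xs} → Eval O (projC i) xs (lookup xs i)
    ev-oracle : ∀ {x} → Eval O oracleC (x ∷ []) (χ (O x))
    ev-comp   : ∀ {m n} {f : Code m} {gs : Vec (Code n) m} {xs ys v} →
                EvalAll O xs gs ys → Eval O f ys v → Eval O (compC f gs) xs v
    ev-prec0  : ∀ {n} {g : Code n} {h xs v} →
                Eval O g xs v → Eval O (precC g h) (0 ∷ xs) v
    ev-precS  : ∀ {n} {g : Code n} {h k xs r v} →
                Eval O (precC g h) (k ∷ xs) r →
                Eval O h (k ∷ r ∷ xs) v →
                Eval O (precC g h) (suc k ∷ xs) v
    ev-mu     : ∀ {n} {f : Code (suc n)} {xs y} →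
                Eval O f (y ∷ xs) 0 →
                (∀ z → z < y → Σ ℕ λ w → Eval O f (z ∷ xs) (suc w)) →
                Eval O (muC f) xs y

  data EvalAll (O : Setω) {n : ℕ} (xs : Vec ℕ n) :
       ∀ {m} → Vec (Code n) m → Vec ℕ m → Set where
    []  : EvalAll O xs [] []
    _∷_ : ∀ {m g v} {gs : Vec (Code n) m} {vs} →
          Eval O g xs v → EvalAll O xs gs vs → EvalAll O xs (g ∷ gs) (v ∷ vs)

_≤T_ : Setω → Setω → Set
A ≤T B = Σ (Code 1) λ e → ∀ n → Eval B e (n ∷ []) (χ (A n))

-- Posets coded as sets: X codes the poset with domain
--   P = { x | 2x ∈ X }   and relation   x ≤_P y  iff  2·⟨x,y⟩+1 ∈ X.

module _ (X : Setω) where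
  InP : ℕ → Set
  InP x = (2 * x) ∈ X

  Le : ℕ → ℕ → Set
  Le x y = suc (2 * pair x y) ∈ X

  Comparable : ℕ → ℕ → Set
  Comparable x y = Le x y ⊎ Le y x

  IsPoset : Set
  IsPoset = (∀ x → InP x → Le x x)
          × (∀ x y → InP x → InP y → Le x y → Le y x → x ≡ y)
          × (∀ x y z → InP x → InP y → InP z → Le x y → Le y z → Le x z)

  InfiniteP : Set
  InfiniteP = ∀ n → Σ ℕ λ m → n ≤ m × InP m

  Small Large Isolated : ℕ → Set
  Small x    = Σ ℕ λ N → ∀ y → N ≤ y → InP y → Le x y
  Large x    = Σ ℕ λ N → ∀ y → N ≤ y → InP y → Le y x
  Isolated x = Σ ℕ λ N → ∀ y → N ≤ y → InP y → ¬ Comparable x y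

  Stable : Set
  Stable = (∀ x → InP x → Small x ⊎ Isolated x)
         ⊎ (∀ x → InP x → Large x ⊎ Isolated x)

  ωOrdered : Set
  ωOrdered = ∀ x y → InP x → InP y → Le x y → x ≤ y

  IsSolution : Setω → Set
  IsSolution Y = (∀ n → Σ ℕ λ m → n ≤ m × m ∈ Y)
               × (∀ x → x ∈ Y → InP x)
               × ((∀ x y → x ∈ Y → y ∈ Y → Comparable x y)
                  ⊎ (∀ x y → x ∈ Y → y ∈ Y → x ≢ y → ¬ Comparable x y))

SCAC-Inst : Setω → Set
SCAC-Inst X = IsPoset X × InfiniteP X × Stable X

ωSCAC-Inst : Setω → Set
ωSCAC-Inst X = SCAC-Inst X × ωOrdered X

record Problem : Set₁ where
  field
    Inst : Setω → Set
    Sol  : Setω → Setω → Set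

open Problem

SCAC : Problem
SCAC = record { Inst = SCAC-Inst ; Sol = IsSolution }

ωSCAC : Problem
ωSCAC = record { Inst = ωSCAC-Inst ; Sol = IsSolution }

_≤c_ : Problem → Problem → Set
P ≤c Q = ∀ X → Inst P X →
         Σ Setω λ X̂ → Inst Q X̂ × (X̂ ≤T X) ×
           (∀ Ŷ → Sol Q X̂ Ŷ → Σ Setω λ Y → Sol P X Y × (Y ≤T (X ⊕ Ŷ)))

module Submission where

-- An ω-ordered stable poset is in particular a stable poset, so ωSCAC ≤c SCAC is witnessed by
-- the identity.  For SCAC ≤c ωSCAC, first reverse the order if necessary (this is computable:
-- the pairing function is inverted by bounded search), so that every element is small or
-- isolated.  Then keep only those y ∈ P that lie below no earlier element, i.e. there is no
-- x < y in P with y ≤_P x.  This subposet is ω-ordered by construction and its chains and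
-- antichains are chains and antichains of P.  It is still infinite: every x ∈ P lies above only
-- finitely many elements of P, so from some point on no element of P lies below any x < n;
-- starting there and repeatedly moving up to an earlier element of P, one never drops below n,
-- so this descent in indices ends at a kept element.

open import Defs
open import Data.Bool using (Bool; true; false; not; _∧_; _∨_; if_then_else_)
open import Data.Bool.Properties
  using (not-involutive; not-injective; ∨-zeroʳ; ∧-conicalˡ; ∧-conicalʳ; ⇔→≡; T-≡)
open import Data.Empty using (⊥-elim)
open import Data.Fin using (Fin) renaming (zero to fzero; suc to fsuc)
open import Data.Nat
  using (ℕ; zero; suc; pred; _+_; _*_; _∸_; _≤_; _<_; _⊔_; _≡ᵇ_; _≤?_; z≤n; s≤s; s≤s⁻¹)
open import Data.Nat.Induction using (<-wellFounded)
open import Data.Nat.Properties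
open import Data.Product using (Σ; _×_; _,_; proj₁; proj₂)
open import Data.Sum using (_⊎_; inj₁; inj₂; swap) renaming (map to map⊎)
open import Data.Vec using (Vec; []; _∷_; lookup; tabulate)
open import Data.Vec.Properties using (tabulate∘lookup)
open import Function using (_∘_)
open import Function.Bundles using (mk⇔; Equivalence)
open import Induction.WellFounded using (Acc; acc)
open import Relation.Binary.Definitions using (tri<; tri≈; tri>)
open import Relation.Binary.PropositionalEquality using (_≡_; refl; sym; trans; cong; cong₂; subst)
open import Relation.Nullary using (¬_; yes; no)

isEven-double : ∀ n → isEven (2 * n) ≡ true
isEven-double zero = refl
isEven-double (suc n) = trans (cong isEven (*-suc 2 n)) (isEven-double n)

half-double : ∀ n → half (2 * n) ≡ n
half-double zero = refl
half-double (suc n) = trans (cong half (*-suc 2 n)) (cong suc (half-double n))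

isEven-suc-double : ∀ n → isEven (suc (2 * n)) ≡ false
isEven-suc-double zero = refl
isEven-suc-double (suc n) = trans (cong (isEven ∘ suc) (*-suc 2 n)) (isEven-suc-double n)

half-suc-double : ∀ n → half (suc (2 * n)) ≡ n
half-suc-double zero = refl
half-suc-double (suc n) = trans (cong (half ∘ suc) (*-suc 2 n)) (cong suc (half-suc-double n))

⊕-even : ∀ (A B : Setω) n → (A ⊕ B) (2 * n) ≡ A n
⊕-even A B n rewrite isEven-double n | half-double n = refl

⊕-odd : ∀ (A B : Setω) n → (A ⊕ B) (suc (2 * n)) ≡ B n
⊕-odd A B n rewrite isEven-suc-double n | half-suc-double n = refl

isEven-suc : ∀ n → isEven (suc n) ≡ not (isEven n)
isEven-suc zero = refl
isEven-suc (suc n) = sym (trans (cong not (isEven-suc n)) (not-involutive (isEven n)))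

half-suc : ∀ n → half (suc n) ≡ half n + χ (not (isEven n))
half-suc zero = refl
half-suc (suc zero) = refl
half-suc (suc (suc n)) = cong suc (half-suc n)

n≤tri : ∀ n → n ≤ tri n
n≤tri zero = z≤n
n≤tri (suc n) = m≤m+n (suc n) (tri n)

tri-mono-≤ : ∀ {m n} → m ≤ n → tri m ≤ tri n
tri-mono-≤ {zero} _ = z≤n
tri-mono-≤ {suc m} {suc n} (s≤s m≤n) = +-mono-≤ (s≤s m≤n) (tri-mono-≤ m≤n)

m≤pair : ∀ m n → m ≤ pair m n
m≤pair m n = ≤-trans (m≤m+n m n) (≤-trans (n≤tri (m + n)) (m≤m+n (tri (m + n)) n))

n≤pair : ∀ m n → n ≤ pair m n
n≤pair m n = m≤n+m n (tri (m + n))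

tri+-<-tri+ : ∀ {s s' y y'} → y ≤ s → s < s' → tri s + y < tri s' + y'
tri+-<-tri+ {s} {s'} {y} {y'} y≤s s<s' = begin-strict
  tri s + y     <⟨ +-monoʳ-< (tri s) (s≤s y≤s) ⟩
  tri s + suc s ≡⟨ +-comm (tri s) (suc s) ⟩
  tri (suc s)   ≤⟨ tri-mono-≤ s<s' ⟩
  tri s'        ≤⟨ m≤m+n (tri s') y' ⟩
  tri s' + y'   ∎
  where open ≤-Reasoning

tri+-injectiveˡ : ∀ {s s' y y'} → y ≤ s → y' ≤ s' → tri s + y ≡ tri s' + y' → s ≡ s'
tri+-injectiveˡ {s} {s'} y≤s y'≤s' eq with <-cmp s s'
... | tri< s<s' _ _ = ⊥-elim (<-irrefl eq (tri+-<-tri+ y≤s s<s'))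
... | tri≈ _ s≡s' _ = s≡s'
... | tri> _ _ s'<s = ⊥-elim (<-irrefl (sym eq) (tri+-<-tri+ y'≤s' s'<s))

pair-injective : ∀ {i j x y} → pair i j ≡ pair x y → i ≡ x × j ≡ y
pair-injective {i} {j} {x} {y} eq = i≡x , j≡y
  where
  sums : i + j ≡ x + y
  sums = tri+-injectiveˡ (m≤n+m j i) (m≤n+m y x) eq

  j≡y : j ≡ y
  j≡y = +-cancelˡ-≡ (tri (x + y)) j y (subst (λ s → tri s + j ≡ tri (x + y) + y) sums eq)

  i≡x : i ≡ x
  i≡x = +-cancelʳ-≡ j i x (subst (λ t → i + j ≡ x + t) (sym j≡y) sums)

anyBelow : (ℕ → Bool) → ℕ → Bool
anyBelow f zero = false
anyBelow f (suc m) = anyBelow f m ∨ f m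

anyBelow⁺ : ∀ f {m i} → i < m → f i ≡ true → anyBelow f m ≡ true
anyBelow⁺ f {suc m} {i} i<1+m fi with m≤n⇒m<n∨m≡n (s≤s⁻¹ i<1+m)
... | inj₁ i<m rewrite anyBelow⁺ f i<m fi = refl
... | inj₂ refl rewrite fi = ∨-zeroʳ (anyBelow f i)

anyBelow⁻ : ∀ f m → anyBelow f m ≡ true → Σ ℕ λ i → i < m × f i ≡ true
anyBelow⁻ f (suc m) found with anyBelow f m in earlier
... | true  = let i , i<m , fi = anyBelow⁻ f m earlier in i , m<n⇒m<1+n i<m , fi
... | false = m , ≤-refl , found

var₀ : ∀ {n} → Code (suc n)
var₀ = projC fzero

var₁ : ∀ {n} → Code (suc (suc n))
var₁ = projC (fsuc fzero)

var₂ : ∀ {n} → Code (suc (suc (suc n)))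
var₂ = projC (fsuc (fsuc fzero))

app₁ : ∀ {n} → Code 1 → Code n → Code n
app₁ f a = compC f (a ∷ [])

app₂ : ∀ {n} → Code 2 → Code n → Code n → Code n
app₂ f a b = compC f (a ∷ b ∷ [])

sucC : ∀ {n} → Code n → Code n
sucC = app₁ succC

oneC : ∀ {n} → Code n
oneC = sucC zeroC

plusC : ∀ {n} → Code n → Code n → Code n
plusC = app₂ (precC var₀ (sucC var₁))

doubleC : ∀ {n} → Code n → Code n
doubleC a = plusC a a

monusC : ∀ {n} → Code n → Code n → Code n
monusC a b = app₂ (precC var₀ (app₁ (precC zeroC var₀) var₁)) b a

isZeroC : ∀ {n} → Code n → Code n
isZeroC = app₁ (precC oneC zeroC)

notC : ∀ {n} → Code n → Code n
notC = isZeroC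

andC : ∀ {n} → Code n → Code n → Code n
andC a b = notC (plusC (notC a) (notC b))

orC : ∀ {n} → Code n → Code n → Code n
orC a b = notC (andC (notC a) (notC b))

ifC : ∀ {n} → Code n → Code n → Code n → Code n
ifC c a b = orC (andC c a) (andC (notC c) b)

eqC : ∀ {n} → Code n → Code n → Code n
eqC a b = isZeroC (plusC (monusC a b) (monusC b a))

pairC : ∀ {n} → Code n → Code n → Code n
pairC a b = plusC (app₁ (precC zeroC (plusC (sucC var₀) var₁)) (plusC a b)) b

isEvenC : ∀ {n} → Code n → Code n
isEvenC = app₁ (precC oneC (notC var₁))

halfC : ∀ {n} → Code n → Code n
halfC = app₁ (precC zeroC (plusC var₁ (notC (isEvenC var₀))))

dropSecond : ∀ n → Vec (Code (suc (suc n))) (suc n)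
dropSecond n = var₀ ∷ tabulate (λ i → projC (fsuc (fsuc i)))

anyBelowC : ∀ {n} → Code (suc n) → Code (suc n)
anyBelowC {n} t = precC zeroC (orC var₁ (compC t (dropSecond n)))

module _ {O : Setω} where

  eval-χ-≡ : ∀ {n e} {xs : Vec ℕ n} {b c} → b ≡ c → Eval O e xs (χ b) → Eval O e xs (χ c)
  eval-χ-≡ refl ev = ev

  eval-app₁ : ∀ {n f a} {xs : Vec ℕ n} {u v} →
              Eval O f (u ∷ []) v → Eval O a xs u → Eval O (app₁ f a) xs v
  eval-app₁ ef ea = ev-comp (ea ∷ []) ef

  eval-app₂ : ∀ {n f a b} {xs : Vec ℕ n} {u w v} →
              Eval O f (u ∷ w ∷ []) v → Eval O a xs u → Eval O b xs w → Eval O (app₂ f a b) xs v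
  eval-app₂ ef ea eb = ev-comp (ea ∷ eb ∷ []) ef

  eval-sucC : ∀ {n a} {xs : Vec ℕ n} {u} → Eval O a xs u → Eval O (sucC a) xs (suc u)
  eval-sucC = eval-app₁ ev-succ

  eval-oneC : ∀ {n} {xs : Vec ℕ n} → Eval O oneC xs 1
  eval-oneC = eval-sucC ev-zero

  eval-plusC : ∀ {n a b} {xs : Vec ℕ n} {u v} →
               Eval O a xs u → Eval O b xs v → Eval O (plusC a b) xs (u + v)
  eval-plusC = eval-app₂ (plus _ _)
    where
    plus : ∀ x y → Eval O (precC var₀ (sucC var₁)) (x ∷ y ∷ []) (x + y)
    plus zero y = ev-prec0 ev-proj
    plus (suc x) y = ev-precS (plus x y) (eval-sucC ev-proj)

  eval-doubleC : ∀ {n a} {xs : Vec ℕ n} {u} → Eval O a xs u → Eval O (doubleC a) xs (2 * u)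
  eval-doubleC {u = u} ea = subst (Eval O _ _) (cong (u +_) (sym (+-identityʳ u))) (eval-plusC ea ea)

  eval-monusC : ∀ {n a b} {xs : Vec ℕ n} {u v} →
                Eval O a xs u → Eval O b xs v → Eval O (monusC a b) xs (u ∸ v)
  eval-monusC ea eb = eval-app₂ (monus _ _) eb ea
    where
    predecessor : ∀ x → Eval O (precC zeroC var₀) (x ∷ []) (pred x)
    predecessor zero = ev-prec0 ev-zero
    predecessor (suc x) = ev-precS (predecessor x) ev-proj

    monus : ∀ y x → Eval O (precC var₀ (app₁ (precC zeroC var₀) var₁)) (y ∷ x ∷ []) (x ∸ y)
    monus zero x = ev-prec0 ev-proj
    monus (suc y) x = subst (Eval O _ _) (pred[m∸n]≡m∸[1+n] x y)
                        (ev-precS (monus y x) (eval-app₁ (predecessor _) ev-proj))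

  eval-isZeroC : ∀ {n a} {xs : Vec ℕ n} {u} → Eval O a xs u → Eval O (isZeroC a) xs (χ (u ≡ᵇ 0))
  eval-isZeroC = eval-app₁ (isZero _)
    where
    isZero : ∀ x → Eval O (precC oneC zeroC) (x ∷ []) (χ (x ≡ᵇ 0))
    isZero zero = ev-prec0 eval-oneC
    isZero (suc x) = ev-precS (isZero x) ev-zero

  eval-notC : ∀ {n a} {xs : Vec ℕ n} {b} → Eval O a xs (χ b) → Eval O (notC a) xs (χ (not b))
  eval-notC {b = true} = eval-isZeroC
  eval-notC {b = false} = eval-isZeroC

  eval-andC : ∀ {n a b} {xs : Vec ℕ n} {u v} →
              Eval O a xs (χ u) → Eval O b xs (χ v) → Eval O (andC a b) xs (χ (u ∧ v))
  eval-andC {u = u} {v} ea eb =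
    eval-χ-≡ (lemma u v) (eval-isZeroC (eval-plusC (eval-notC ea) (eval-notC eb)))
    where
    lemma : ∀ u v → (χ (not u) + χ (not v) ≡ᵇ 0) ≡ (u ∧ v)
    lemma true true = refl
    lemma true false = refl
    lemma false v = refl

  eval-orC : ∀ {n a b} {xs : Vec ℕ n} {u v} →
             Eval O a xs (χ u) → Eval O b xs (χ v) → Eval O (orC a b) xs (χ (u ∨ v))
  eval-orC {u = u} {v} ea eb =
    eval-χ-≡ (lemma u v) (eval-notC (eval-andC (eval-notC ea) (eval-notC eb)))
    where
    lemma : ∀ u v → not (not u ∧ not v) ≡ (u ∨ v)
    lemma true v = refl
    lemma false v = not-involutive v

  eval-ifC : ∀ {n c a b} {xs : Vec ℕ n} {t u v} →
             Eval O c xs (χ t) → Eval O a xs (χ u) → Eval O b xs (χ v) →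
             Eval O (ifC c a b) xs (χ (if t then u else v))
  eval-ifC {t = t} {u} {v} ec ea eb =
    eval-χ-≡ (lemma t u v) (eval-orC (eval-andC ec ea) (eval-andC (eval-notC ec) eb))
    where
    lemma : ∀ t u v → ((t ∧ u) ∨ (not t ∧ v)) ≡ (if t then u else v)
    lemma true true v = refl
    lemma true false v = refl
    lemma false u v = refl

  eval-eqC : ∀ {n a b} {xs : Vec ℕ n} {u v} →
             Eval O a xs u → Eval O b xs v → Eval O (eqC a b) xs (χ (u ≡ᵇ v))
  eval-eqC {u = u} {v} ea eb =
    eval-χ-≡ (lemma u v) (eval-isZeroC (eval-plusC (eval-monusC ea eb) (eval-monusC eb ea)))
    where
    lemma : ∀ u v → ((u ∸ v) + (v ∸ u) ≡ᵇ 0) ≡ (u ≡ᵇ v)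
    lemma zero zero = refl
    lemma zero (suc v) = refl
    lemma (suc u) zero = refl
    lemma (suc u) (suc v) = lemma u v

  eval-pairC : ∀ {n a b} {xs : Vec ℕ n} {u v} →
               Eval O a xs u → Eval O b xs v → Eval O (pairC a b) xs (pair u v)
  eval-pairC ea eb = eval-plusC (eval-app₁ (triangle _) (eval-plusC ea eb)) eb
    where
    triangle : ∀ x → Eval O (precC zeroC (plusC (sucC var₀) var₁)) (x ∷ []) (tri x)
    triangle zero = ev-prec0 ev-zero
    triangle (suc x) = ev-precS (triangle x) (eval-plusC (eval-sucC ev-proj) ev-proj)

  eval-isEvenC : ∀ {n a} {xs : Vec ℕ n} {u} → Eval O a xs u → Eval O (isEvenC a) xs (χ (isEven u))
  eval-isEvenC = eval-app₁ (parity _)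
    where
    parity : ∀ x → Eval O (precC oneC (notC var₁)) (x ∷ []) (χ (isEven x))
    parity zero = ev-prec0 eval-oneC
    parity (suc x) = eval-χ-≡ (sym (isEven-suc x))
                       (ev-precS (parity x) (eval-notC ev-proj))

  eval-halfC : ∀ {n a} {xs : Vec ℕ n} {u} → Eval O a xs u → Eval O (halfC a) xs (half u)
  eval-halfC = eval-app₁ (halving _)
    where
    halving : ∀ x → Eval O (precC zeroC (plusC var₁ (notC (isEvenC var₀)))) (x ∷ []) (half x)
    halving zero = ev-prec0 ev-zero
    halving (suc x) = subst (Eval O _ _) (sym (half-suc x))
                        (ev-precS (halving x) (eval-plusC ev-proj (eval-notC (eval-isEvenC ev-proj))))

  eval-dropSecond : ∀ {n} (xs : Vec ℕ n) j r → EvalAll O (j ∷ r ∷ xs) (dropSecond n) (j ∷ xs)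
  eval-dropSecond xs j r =
    ev-proj ∷ subst (EvalAll O _ _) (tabulate∘lookup xs) (projections (λ i → fsuc (fsuc i)))
    where
    projections : ∀ {k} (ρ : Fin k → Fin _) →
                  EvalAll O (j ∷ r ∷ xs) (tabulate (λ i → projC (ρ i)))
                                          (tabulate (λ i → lookup (j ∷ r ∷ xs) (ρ i)))
    projections {zero} ρ = []
    projections {suc k} ρ = ev-proj ∷ projections (λ i → ρ (fsuc i))

  eval-anyBelowC : ∀ {n} {t : Code (suc n)} (f : Vec ℕ n → ℕ → Bool) →
                   (∀ xs j → Eval O t (j ∷ xs) (χ (f xs j))) →
                   ∀ m xs → Eval O (anyBelowC t) (m ∷ xs) (χ (anyBelow (f xs) m))
  eval-anyBelowC f et zero xs = ev-prec0 ev-zero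
  eval-anyBelowC f et (suc m) xs =
    ev-precS (eval-anyBelowC f et m xs) (eval-orC ev-proj (ev-comp (eval-dropSecond xs m _) (et xs m)))

domain relation : Setω → ℕ → Bool
domain X y = X (2 * y)
relation X k = X (suc (2 * k))

liesAbove : Setω → ℕ → ℕ → Bool
liesAbove X y x = domain X x ∧ relation X (pair y x)

hasEarlierAbove : Setω → ℕ → Bool
hasEarlierAbove X y = anyBelow (liesAbove X y) y

kept : Setω → ℕ → Bool
kept X y = domain X y ∧ not (hasEarlierAbove X y)

prune : Setω → Setω
prune X = kept X ⊕ relation X

swappedPairIs : Setω → ℕ → ℕ → ℕ → Bool
swappedPairIs X k i j = (pair i j ≡ᵇ k) ∧ relation X (pair j i)

-- This is relation X (pair y x) at k = pair x y, decoding k by a search bounded by k.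
reversedRelation : Setω → ℕ → Bool
reversedRelation X k = anyBelow (λ i → anyBelow (swappedPairIs X k i) (suc k)) (suc k)

reverse : Setω → Setω
reverse X = domain X ⊕ reversedRelation X

SmallOrIsolated LargeOrIsolated : Setω → Set
SmallOrIsolated X = ∀ x → InP X x → Small X x ⊎ Isolated X x
LargeOrIsolated X = ∀ x → InP X x → Large X x ⊎ Isolated X x

≤T-refl : ∀ {A} → A ≤T A
≤T-refl = oracleC , λ n → ev-oracle

≤T-resp : ∀ {A B O} → (∀ n → A n ≡ B n) → A ≤T O → B ≤T O
≤T-resp A≗B (e , he) = e , λ n → subst (λ b → Eval _ e (n ∷ []) (χ b)) (A≗B n) (he n)

⊕-≤T : ∀ {A B O} → A ≤T O → B ≤T O → (A ⊕ B) ≤T O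
⊕-≤T (a , ha) (b , hb) =
  ifC (isEvenC var₀) (app₁ a (halfC var₀)) (app₁ b (halfC var₀)) ,
  λ n → eval-ifC (eval-isEvenC ev-proj) (eval-app₁ (ha _) (eval-halfC ev-proj))
                                         (eval-app₁ (hb _) (eval-halfC ev-proj))

∧-≤T : ∀ {A B O} → A ≤T O → B ≤T O → (λ n → A n ∧ B n) ≤T O
∧-≤T (a , ha) (b , hb) = andC a b , λ n → eval-andC (ha n) (hb n)

not-≤T : ∀ {A O} → A ≤T O → (λ n → not (A n)) ≤T O
not-≤T (a , ha) = notC a , λ n → eval-notC (ha n)

module _ {X O : Setω} (X≤TO : X ≤T O) where

  private
    callC : ∀ {n} → Code n → Code n
    callC = app₁ (proj₁ X≤TO)

    eval-callC : ∀ {n a} {xs : Vec ℕ n} {u} → Eval O a xs u → Eval O (callC a) xs (χ (X u))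
    eval-callC = eval-app₁ (proj₂ X≤TO _)

    domainC : ∀ {n} → Code n → Code n
    domainC a = callC (doubleC a)

    eval-domainC : ∀ {n a} {xs : Vec ℕ n} {u} → Eval O a xs u → Eval O (domainC a) xs (χ (domain X u))
    eval-domainC ea = eval-callC (eval-doubleC ea)

    relationC : ∀ {n} → Code n → Code n
    relationC a = callC (sucC (doubleC a))

    eval-relationC : ∀ {n a} {xs : Vec ℕ n} {u} → Eval O a xs u → Eval O (relationC a) xs (χ (relation X u))
    eval-relationC ea = eval-callC (eval-sucC (eval-doubleC ea))

  domain-≤T : domain X ≤T O
  domain-≤T = domainC var₀ , λ n → eval-domainC ev-proj

  relation-≤T : relation X ≤T O
  relation-≤T = relationC var₀ , λ n → eval-relationC ev-proj

  hasEarlierAbove-≤T : hasEarlierAbove X ≤T O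
  hasEarlierAbove-≤T =
    compC (anyBelowC (andC (domainC var₀) (relationC (pairC var₁ var₀)))) (var₀ ∷ var₀ ∷ []) ,
    λ y → ev-comp (ev-proj ∷ ev-proj ∷ []) (eval-anyBelowC liesAbove′ evalLiesAbove y (y ∷ []))
    where
    liesAbove′ : Vec ℕ 1 → ℕ → Bool
    liesAbove′ (y ∷ []) = liesAbove X y

    evalLiesAbove : ∀ xs x → Eval O (andC (domainC var₀) (relationC (pairC var₁ var₀))) (x ∷ xs)
                                     (χ (liesAbove′ xs x))
    evalLiesAbove (y ∷ []) x = eval-andC (eval-domainC ev-proj) (eval-relationC (eval-pairC ev-proj ev-proj))

  reversedRelation-≤T : reversedRelation X ≤T O
  reversedRelation-≤T =
    compC (anyBelowC outer) (sucC var₀ ∷ var₀ ∷ []) ,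
    λ k → ev-comp (eval-sucC ev-proj ∷ ev-proj ∷ []) (eval-anyBelowC outerF evalOuter (suc k) (k ∷ []))
    where
    inner : Code 3
    inner = andC (eqC (pairC var₁ var₀) var₂) (relationC (pairC var₀ var₁))

    innerF : Vec ℕ 2 → ℕ → Bool
    innerF (i ∷ k ∷ []) = swappedPairIs X k i

    evalInner : ∀ xs j → Eval O inner (j ∷ xs) (χ (innerF xs j))
    evalInner (i ∷ k ∷ []) j =
      eval-andC (eval-eqC (eval-pairC ev-proj ev-proj) ev-proj) (eval-relationC (eval-pairC ev-proj ev-proj))

    outer : Code 2
    outer = compC (anyBelowC inner) (sucC var₁ ∷ var₀ ∷ var₁ ∷ [])

    outerF : Vec ℕ 1 → ℕ → Bool
    outerF (k ∷ []) i = anyBelow (swappedPairIs X k i) (suc k)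

    evalOuter : ∀ xs i → Eval O outer (i ∷ xs) (χ (outerF xs i))
    evalOuter (k ∷ []) i =
      ev-comp (eval-sucC ev-proj ∷ ev-proj ∷ ev-proj ∷ []) (eval-anyBelowC innerF evalInner (suc k) (i ∷ k ∷ []))

  prune-≤T : prune X ≤T O
  prune-≤T = ⊕-≤T (∧-≤T domain-≤T (not-≤T hasEarlierAbove-≤T)) relation-≤T

  reverse-≤T : reverse X ≤T O
  reverse-≤T = ⊕-≤T domain-≤T reversedRelation-≤T

≤T-⊕ʳ : ∀ A B → B ≤T (A ⊕ B)
≤T-⊕ʳ A B = ≤T-resp (⊕-odd A B) (relation-≤T ≤T-refl)

IsSolution-transfer : ∀ {X Z Y} →
                      (∀ x → InP Z x → InP X x) →
                      (∀ x y → Comparable Z x y → Comparable X x y) →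
                      (∀ x y → Comparable X x y → Comparable Z x y) →
                      IsSolution Z Y → IsSolution X Y
IsSolution-transfer inP cmp⁻ cmp⁺ (infinite , inZ , inj₁ chain) =
  infinite , (λ x x∈Y → inP x (inZ x x∈Y)) , inj₁ (λ x y x∈Y y∈Y → cmp⁻ x y (chain x y x∈Y y∈Y))
IsSolution-transfer inP cmp⁻ cmp⁺ (infinite , inZ , inj₂ antichain) =
  infinite , (λ x x∈Y → inP x (inZ x x∈Y)) ,
  inj₂ (λ x y x∈Y y∈Y x≢y c → antichain x y x∈Y y∈Y x≢y (cmp⁺ x y c))

module _ (X : Setω) where

  hasEarlierAbove⁺ : ∀ {x y} → x < y → InP X x → Le X y x → hasEarlierAbove X y ≡ true
  hasEarlierAbove⁺ x<y px y≤x = anyBelow⁺ _ x<y (cong₂ _∧_ px y≤x)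

  hasEarlierAbove⁻ : ∀ y → hasEarlierAbove X y ≡ true → Σ ℕ λ x → x < y × InP X x × Le X y x
  hasEarlierAbove⁻ y h =
    let x , x<y , found = anyBelow⁻ _ y h in x , x<y , ∧-conicalˡ _ _ found , ∧-conicalʳ _ _ found

  InP-prune⁻ : ∀ y → InP (prune X) y → InP X y
  InP-prune⁻ y py = ∧-conicalˡ _ _ (trans (sym (⊕-even (kept X) (relation X) y)) py)

  hasEarlierAbove-prune : ∀ y → InP (prune X) y → hasEarlierAbove X y ≡ false
  hasEarlierAbove-prune y py = not-injective (∧-conicalʳ _ _ (trans (sym (⊕-even (kept X) (relation X) y)) py))

  InP-prune⁺ : ∀ y → InP X y → hasEarlierAbove X y ≡ false → InP (prune X) y
  InP-prune⁺ y py h = trans (⊕-even (kept X) (relation X) y) (cong₂ (λ a b → a ∧ not b) py h)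

  Le-prune⁻ : ∀ x y → Le (prune X) x y → Le X x y
  Le-prune⁻ x y = trans (sym (⊕-odd (kept X) (relation X) (pair x y)))

  Le-prune⁺ : ∀ x y → Le X x y → Le (prune X) x y
  Le-prune⁺ x y = trans (⊕-odd (kept X) (relation X) (pair x y))

  Comparable-prune⁻ : ∀ x y → Comparable (prune X) x y → Comparable X x y
  Comparable-prune⁻ x y = map⊎ (Le-prune⁻ x y) (Le-prune⁻ y x)

  Comparable-prune⁺ : ∀ x y → Comparable X x y → Comparable (prune X) x y
  Comparable-prune⁺ x y = map⊎ (Le-prune⁺ x y) (Le-prune⁺ y x)

  prune-ωOrdered : ωOrdered (prune X)
  prune-ωOrdered x y px py x≤y with x ≤? y
  ... | yes x≤y = x≤y
  ... | no x≰y with trans (sym (hasEarlierAbove-prune x px))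
                         (hasEarlierAbove⁺ (≰⇒> x≰y) (InP-prune⁻ y py) (Le-prune⁻ x y x≤y))
  ... | ()

  prune-IsPoset : IsPoset X → IsPoset (prune X)
  prune-IsPoset (reflexive , antisymmetric , transitive) =
    (λ x px → Le-prune⁺ x x (reflexive x (InP-prune⁻ x px))) ,
    (λ x y px py x≤y y≤x → antisymmetric x y (InP-prune⁻ x px) (InP-prune⁻ y py)
                                               (Le-prune⁻ x y x≤y) (Le-prune⁻ y x y≤x)) ,
    (λ x y z px py pz x≤y y≤z → Le-prune⁺ x z
      (transitive x y z (InP-prune⁻ x px) (InP-prune⁻ y py) (InP-prune⁻ z pz)
                        (Le-prune⁻ x y x≤y) (Le-prune⁻ y z y≤z)))

  prune-SmallOrIsolated : SmallOrIsolated X → SmallOrIsolated (prune X)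
  prune-SmallOrIsolated soi x px with soi x (InP-prune⁻ x px)
  ... | inj₁ (N , small) = inj₁ (N , λ y N≤y py → Le-prune⁺ x y (small y N≤y (InP-prune⁻ y py)))
  ... | inj₂ (N , isolated) =
    inj₂ (N , λ y N≤y py c → isolated y N≤y (InP-prune⁻ y py) (Comparable-prune⁻ x y c))

  IsSolution-prune : ∀ {Y} → IsSolution (prune X) Y → IsSolution X Y
  IsSolution-prune = IsSolution-transfer {X} {prune X} InP-prune⁻ Comparable-prune⁻ Comparable-prune⁺

NoneAbove : Setω → ℕ → ℕ → Set
NoneAbove X n y = ∀ x → x < n → InP X x → ¬ Le X y x

module _ (X : Setω) (poset : IsPoset X) (soi : SmallOrIsolated X) where

  private
    antisymmetric = proj₁ (proj₂ poset)
    transitive = proj₂ (proj₂ poset)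

  finitelyManyBelow : ∀ x → Σ ℕ λ N → InP X x → ∀ y → N ≤ y → InP X y → ¬ Le X y x
  finitelyManyBelow x with X (2 * x) in px
  ... | false = 0 , λ ()
  ... | true with soi x px
  ... | inj₁ (N , small) = N ⊔ suc x , λ _ y bound py y≤x →
          <-irrefl (antisymmetric x y px py (small y (m⊔n≤o⇒m≤o N (suc x) bound) py) y≤x)
                   (m⊔n≤o⇒n≤o N (suc x) bound)
  ... | inj₂ (N , isolated) = N , λ _ y N≤y py y≤x → isolated y N≤y py (inj₂ y≤x)

  eventuallyNoneAbove : ∀ n → Σ ℕ λ M → n ≤ M × (∀ y → M ≤ y → InP X y → NoneAbove X n y)
  eventuallyNoneAbove zero = 0 , z≤n , λ _ _ _ _ ()
  eventuallyNoneAbove (suc n) with eventuallyNoneAbove n | finitelyManyBelow n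
  ... | M , n≤M , noneAbove | N , notBelow = M ⊔ N ⊔ suc n , m≤n⊔m (M ⊔ N) (suc n) , noneAbove′
    where
    noneAbove′ : ∀ y → M ⊔ N ⊔ suc n ≤ y → InP X y → NoneAbove X (suc n) y
    noneAbove′ y bound py x x<1+n px with m≤n⇒m<n∨m≡n (s≤s⁻¹ x<1+n)
    ... | inj₁ x<n = noneAbove y (m⊔n≤o⇒m≤o M N (m⊔n≤o⇒m≤o (M ⊔ N) (suc n) bound)) py x x<n px
    ... | inj₂ refl = notBelow px y (m⊔n≤o⇒n≤o M N (m⊔n≤o⇒m≤o (M ⊔ N) (suc n) bound)) py

  climb : ∀ n y → Acc _<_ y → n ≤ y → InP X y → NoneAbove X n y →
          Σ ℕ λ m → n ≤ m × InP (prune X) m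
  climb n y (acc rs) n≤y py noneAbove with hasEarlierAbove X y in h
  ... | false = y , n≤y , InP-prune⁺ X y py h
  ... | true with hasEarlierAbove⁻ X y h
  ... | x , x<y , px , y≤x with n ≤? x
  ... | no n≰x = ⊥-elim (noneAbove x (≰⇒> n≰x) px y≤x)
  ... | yes n≤x = climb n x (rs x<y) n≤x px
                    (λ z z<n pz x≤z → noneAbove z z<n pz (transitive y x z py px pz y≤x x≤z))

  prune-InfiniteP : InfiniteP X → InfiniteP (prune X)
  prune-InfiniteP infinite n =
    let M , n≤M , noneAbove = eventuallyNoneAbove n
        y , M≤y , py = infinite M
    in climb n y (<-wellFounded y) (≤-trans n≤M M≤y) py (noneAbove y M≤y py)

module _ (X : Setω) where

  InP-reverse⁻ : ∀ y → InP (reverse X) y → InP X y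
  InP-reverse⁻ y = trans (sym (⊕-even (domain X) (reversedRelation X) y))

  InP-reverse⁺ : ∀ y → InP X y → InP (reverse X) y
  InP-reverse⁺ y = trans (⊕-even (domain X) (reversedRelation X) y)

  reversedRelation-pair : ∀ x y → reversedRelation X (pair x y) ≡ relation X (pair y x)
  reversedRelation-pair x y = ⇔→≡ (mk⇔ to from)
    where
    k : ℕ
    k = pair x y

    to : reversedRelation X k ≡ true → relation X (pair y x) ≡ true
    to r with anyBelow⁻ (λ i → anyBelow (swappedPairIs X k i) (suc k)) (suc k) r
    ... | i , _ , found with anyBelow⁻ (swappedPairIs X k i) (suc k) found
    ... | j , _ , match with pair-injective {i} {j} {x} {y} (≡ᵇ⇒≡ _ _ (Equivalence.from T-≡ (∧-conicalˡ _ _ match)))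
    ... | refl , refl = ∧-conicalʳ _ _ match

    from : relation X (pair y x) ≡ true → reversedRelation X k ≡ true
    from y≤x = anyBelow⁺ _ (s≤s (m≤pair x y))
                 (anyBelow⁺ _ (s≤s (n≤pair x y)) (cong₂ _∧_ (Equivalence.to T-≡ (≡⇒≡ᵇ k k refl)) y≤x))

  relation-reverse : ∀ x y → relation (reverse X) (pair x y) ≡ relation X (pair y x)
  relation-reverse x y = trans (⊕-odd (domain X) (reversedRelation X) (pair x y)) (reversedRelation-pair x y)

  Le-reverse⁻ : ∀ x y → Le (reverse X) x y → Le X y x
  Le-reverse⁻ x y = trans (sym (relation-reverse x y))

  Le-reverse⁺ : ∀ x y → Le X y x → Le (reverse X) x y
  Le-reverse⁺ x y = trans (relation-reverse x y)

  Comparable-reverse⁻ : ∀ x y → Comparable (reverse X) x y → Comparable X x y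
  Comparable-reverse⁻ x y = swap ∘ map⊎ (Le-reverse⁻ x y) (Le-reverse⁻ y x)

  Comparable-reverse⁺ : ∀ x y → Comparable X x y → Comparable (reverse X) x y
  Comparable-reverse⁺ x y = map⊎ (Le-reverse⁺ x y) (Le-reverse⁺ y x) ∘ swap

  reverse-IsPoset : IsPoset X → IsPoset (reverse X)
  reverse-IsPoset (reflexive , antisymmetric , transitive) =
    (λ x px → Le-reverse⁺ x x (reflexive x (InP-reverse⁻ x px))) ,
    (λ x y px py x≤y y≤x → antisymmetric x y (InP-reverse⁻ x px) (InP-reverse⁻ y py)
                                               (Le-reverse⁻ y x y≤x) (Le-reverse⁻ x y x≤y)) ,
    (λ x y z px py pz x≤y y≤z → Le-reverse⁺ x z
      (transitive z y x (InP-reverse⁻ z pz) (InP-reverse⁻ y py) (InP-reverse⁻ x px)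
                        (Le-reverse⁻ y z y≤z) (Le-reverse⁻ x y x≤y)))

  reverse-InfiniteP : InfiniteP X → InfiniteP (reverse X)
  reverse-InfiniteP infinite n = let m , n≤m , pm = infinite n in m , n≤m , InP-reverse⁺ m pm

  reverse-SmallOrIsolated : LargeOrIsolated X → SmallOrIsolated (reverse X)
  reverse-SmallOrIsolated loi x px with loi x (InP-reverse⁻ x px)
  ... | inj₁ (N , large) = inj₁ (N , λ y N≤y py → Le-reverse⁺ x y (large y N≤y (InP-reverse⁻ y py)))
  ... | inj₂ (N , isolated) =
    inj₂ (N , λ y N≤y py c → isolated y N≤y (InP-reverse⁻ y py) (Comparable-reverse⁻ x y c))

  IsSolution-reverse : ∀ {Y} → IsSolution (reverse X) Y → IsSolution X Y
  IsSolution-reverse = IsSolution-transfer {X} {reverse X} InP-reverse⁻ Comparable-reverse⁻ Comparable-reverse⁺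

prune-ωSCAC-Inst : ∀ X → IsPoset X → InfiniteP X → SmallOrIsolated X → ωSCAC-Inst (prune X)
prune-ωSCAC-Inst X poset infinite soi =
  (prune-IsPoset X poset , prune-InfiniteP X poset soi infinite , inj₁ (prune-SmallOrIsolated X soi)) ,
  prune-ωOrdered X

SCAC≤cωSCAC : SCAC ≤c ωSCAC
SCAC≤cωSCAC X (poset , infinite , inj₁ soi) =
  prune X , prune-ωSCAC-Inst X poset infinite soi , prune-≤T ≤T-refl ,
  λ Ŷ sol → Ŷ , IsSolution-prune X sol , ≤T-⊕ʳ X Ŷ
SCAC≤cωSCAC X (poset , infinite , inj₂ loi) =
  prune (reverse X) ,
  prune-ωSCAC-Inst (reverse X) (reverse-IsPoset X poset) (reverse-InfiniteP X infinite)
                               (reverse-SmallOrIsolated X loi) ,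
  prune-≤T (reverse-≤T ≤T-refl) ,
  λ Ŷ sol → Ŷ , IsSolution-reverse X (IsSolution-prune (reverse X) sol) , ≤T-⊕ʳ X Ŷ

ωSCAC≤cSCAC : ωSCAC ≤c SCAC
ωSCAC≤cSCAC X (inst , _) = X , inst , ≤T-refl , λ Ŷ sol → Ŷ , sol , ≤T-⊕ʳ X Ŷ

theorem6 : (SCAC ≤c ωSCAC) × (ωSCAC ≤c SCAC)
theorem6 = SCAC≤cωSCAC , ωSCAC≤cSCAC
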